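{- Let $H$ be a connected graph and let $X,Y\subseteq V(H)$. Suppose that $L$ is an $(X,Y)$-pairing and $(\mathcal{X},\mathcal{M})$, with $\mathcal{X}=(X_0,\ldots,X_n)$, is an $L$-movement of length $n$ on $H$. If $x\in X\cup Y$ is strongly $(\mathcal{X},\mathcal{M})$-singular, then: (i) $(\mathcal{X}\triangle x,\mathcal{M})$ is an $(L\triangle x)$-movement of length $n$, where $\mathcal{X}\triangle x=(X_0\triangle\{x\},\ldots,X_n\triangle\{x\})$ and $L\triangle x$ denotes the graph obtained from $L$ by replacing the vertex $(x,0)$ by $(x,\infty)$ or vice versa (at most one of them is a vertex of $L$); (ii) a vertex $y\in V(H)$ is $(\mathcal{X},\mathcal{M})$-singular if and only if it is $(\mathcal{X}\triangle x,\mathcal{M})$-singular, and $y$ is strongly $(\mathcal{X},\mathcal{M})$-singular if and only if it is strongly $(\mathcal{X}\triangle x,\mathcal{M})$-singular.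
   Context: A movement on $H$ is a pair $(\mathcal{X},\mathcal{M})$ with $\mathcal{X}=(X_0,\ldots,X_n)$ subsets of $V(H)$ and $\mathcal{M}=(M_1,\ldots,M_n)$, $n\ge1$, non-trivial paths in $H$ such that for each $i$: $X_{i-1}\triangle X_i$ consists exactly of the two end vertices of $M_i$, and $M_i$ is disjoint from $X_{i-1}\cap X_i$. Its length is $n$. For $i=1,\dots,n$ let $R_i$ be the graph on $(X_{i-1}\times\{i-1\})\cup(X_i\times\{i\})$ with edges $(x,i-1)(x,i)$ for $x\in X_{i-1}\cap X_i$ and one edge $(x,j)(y,k)$ where $x,y$ are the ends of $M_i$ and $j,k$ the unique indices with $(x,j),(y,k)\in V(R_i)$; let $\mathcal{R}$ be the multigraph on $\bigcup_i X_i\times\{i\}$ whose edge multiplicities count the $R_i$ containing the edge. Its components meeting $(X_0\times\{0\})\cup(X_n\times\{n\})$ are paths with both ends in that set; the induced pairing is the graph on $(X_0\times\{0\})\cup(X_n\times\{\infty\})$ (renaming $(x,n)$ as $(x,\infty)$) where two vertices are adjacent iff they are the ends of one such path. For sets $X,Y$, an $(X,Y)$-pairing is any 1-regular graph on $(X\times\{0\})\cup(Y\times\{\infty\})$; an $L$-movement is a movement whose induced pairing is $L$. A vertex $x$ is $(\mathcal{X},\mathcal{M})$-singular if no move contains $x$ as an inner vertex and $I_x=\{i: x\in X_i\}$ is a (possibly empty) set of consecutive integers; it is strongly singular if moreover $I_x$ is empty or contains $0$ or $n$. -}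

module Defs where

open import Data.Bool using (Bool; true; false; if_then_else_; _xor_)
open import Data.Nat using (ℕ; zero; suc; _≤_)
open import Data.Fin using (Fin; inject₁; fromℕ; toℕ) renaming (zero to fzero; suc to fsuc; _≟_ to _≟ᶠ_)
open import Data.Fin.Subset using (Subset; _∈_; _∉_; _∩_; _∪_; ⁅_⁆)
open import Data.Vec using (Vec; zipWith; lookup)
open import Data.List using (List; []; _∷_; _++_; [_])
open import Data.List.Membership.Propositional using () renaming (_∈_ to _∈ˡ_)
open import Data.List.Relation.Unary.Unique.Propositional using (Unique)
open import Data.List.Relation.Unary.Linked using (Linked)
open import Data.Product using (_×_; _,_; Σ; ∃; ∃-syntax)
open import Data.Sum using (_⊎_)
open import Data.Empty using (⊥)
open import Relation.Nullary using (¬_; yes; no)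
open import Relation.Binary.PropositionalEquality using (_≡_; _≢_)
open import Relation.Binary.Construct.Closure.ReflexiveTransitive using (Star)
open import Relation.Binary.Construct.Closure.Symmetric using (SymClosure)
open import Function.Bundles using (_⇔_)

record Graph (v : ℕ) : Set₁ where
  field
    Adj     : Fin v → Fin v → Set
    sym     : ∀ {a b} → Adj a b → Adj b a
    irrefl  : ∀ {a} → ¬ Adj a a
open Graph public

Connected : ∀ {v} → Graph v → Set
Connected {v} H = ∀ (a b : Fin v) → Star (Adj H) a b

-- Paths in H: vertex sequence  start ∷ inner ++ [ end ],
-- all vertices distinct, consecutive vertices adjacent.
-- Distinctness forces start ≢ end, so every such path is non-trivial.

record Path {v : ℕ} (H : Graph v) : Set where
  field
    start  : Fin v
    inner  : List (Fin v)
    end    : Fin v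
  vertices : List (Fin v)
  vertices = start ∷ (inner ++ [ end ])
  field
    distinct : Unique vertices
    linked   : Linked (Adj H) vertices
open Path public

OnPath : ∀ {v} {H : Graph v} → Fin v → Path H → Set
OnPath x P = x ∈ˡ vertices P

InnerOf : ∀ {v} {H : Graph v} → Fin v → Path H → Set
InnerOf x P = x ∈ˡ inner P

_⊕_ : ∀ {v} → Subset v → Subset v → Subset v
_⊕_ = zipWith _xor_

infixl 6 _⊕_

-- X : Fin (suc n) → Subset v  is (X_0,…,X_n),
-- M : Fin n → Path H  is (M_1,…,M_n) (move i : Fin n is M_{i+1},
-- going from X (inject₁ i) = X_i to X (fsuc i) = X_{i+1}).

record PreMovement {v : ℕ} (H : Graph v) (n : ℕ) : Set where
  constructor _,_
  field
    𝓧 : Fin (suc n) → Subset v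
    𝓜 : Fin n → Path H
open PreMovement public

IsMovement : ∀ {v} {H : Graph v} {n} → PreMovement H n → Set
IsMovement {v} {H} {n} (X , M) =
  (1 ≤ n)
  × (∀ (i : Fin n) →
       (X (inject₁ i) ⊕ X (fsuc i) ≡ ⁅ start (M i) ⁆ ∪ ⁅ end (M i) ⁆)
     × (∀ (y : Fin v) → OnPath y (M i) → y ∉ (X (inject₁ i) ∩ X (fsuc i))))

-- The multigraph 𝓡 (only its connectivity matters for the pairing)

module _ {v : ℕ} {H : Graph v} {n : ℕ} (mv : PreMovement H n) where

  private
    X = 𝓧 mv
    M = 𝓜 mv

  RVertex : Set
  RVertex = Fin v × Fin (suc n)

  -- the unique index j ∈ {i-1,i} with (x , j) ∈ V(R_i)  (move i : Fin n)
  moveIdx : Fin n → Fin v → Fin (suc n)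
  moveIdx i x = if lookup (X (inject₁ i)) x then inject₁ i else fsuc i

  data REdge : RVertex → RVertex → Set where
    vertical : ∀ (i : Fin n) (x : Fin v) → x ∈ X (inject₁ i) → x ∈ X (fsuc i) →
               REdge (x , inject₁ i) (x , fsuc i)
    moveEdge : ∀ (i : Fin n) →
               REdge (start (M i) , moveIdx i (start (M i)))
                     (end (M i) , moveIdx i (end (M i)))

  RConnected : RVertex → RVertex → Set
  RConnected = Star (SymClosure REdge)

data Side : Set where
  𝟎 ∞ : Side

Tagged : ℕ → Set
Tagged v = Fin v × Side

InV : ∀ {v} → Subset v → Subset v → Tagged v → Set
InV X Y (x , 𝟎) = x ∈ X
InV X Y (x , ∞) = x ∈ Y

-- a graph on Tagged v is given by its vertex sets (X,Y) and edge relation;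
-- an (X,Y)-pairing is a 1-regular simple graph on (X × {0}) ∪ (Y × {∞})
IsPairing : ∀ {v} → Subset v → Subset v → (Tagged v → Tagged v → Set) → Set
IsPairing {v} X Y L =
    (∀ u w → L u w → InV X Y u × InV X Y w)
  × (∀ u w → L u w → L w u)
  × (∀ u → ¬ L u u)
  × (∀ u → InV X Y u → ∃[ w ] (L u w × (∀ w' → L u w' → w' ≡ w)))

-- embedding of the pairing vertices into 𝓡: (x,∞) is (x,n)
emb : ∀ {v n} → Tagged v → Fin v × Fin (suc n)
emb {n = n} (x , 𝟎) = x , fzero
emb {n = n} (x , ∞) = x , fromℕ n

-- edge relation of the induced pairing: two distinct vertices of
-- (X_0 × {0}) ∪ (X_n × {∞}) lying in the same component of 𝓡
-- (i.e. being the two ends of one such path-component)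
InducedEdge : ∀ {v} {H : Graph v} {n} → PreMovement H n → Tagged v → Tagged v → Set
InducedEdge {n = n} mv u w =
    u ≢ w
  × InV (𝓧 mv fzero) (𝓧 mv (fromℕ n)) u
  × InV (𝓧 mv fzero) (𝓧 mv (fromℕ n)) w
  × RConnected mv (emb u) (emb w)

InducedPairingIs : ∀ {v} {H : Graph v} {n} → PreMovement H n →
                   Subset v → Subset v → (Tagged v → Tagged v → Set) → Set
InducedPairingIs {n = n} mv X Y L =
    (𝓧 mv fzero ≡ X)
  × (𝓧 mv (fromℕ n) ≡ Y)
  × (∀ u w → L u w ⇔ InducedEdge mv u w)

IsLMovement : ∀ {v} {H : Graph v} {n} →
              Subset v → Subset v → (Tagged v → Tagged v → Set) → PreMovement H n → Set
IsLMovement X Y L mv = IsMovement mv × InducedPairingIs mv X Y L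

InI : ∀ {v} {H : Graph v} {n} → PreMovement H n → Fin v → Fin (suc n) → Set
InI mv x i = x ∈ 𝓧 mv i

Singular : ∀ {v} {H : Graph v} {n} → PreMovement H n → Fin v → Set
Singular {n = n} mv x =
    (∀ (i : Fin n) → ¬ InnerOf x (𝓜 mv i))
  × (∀ (i j k : Fin (suc n)) → toℕ i ≤ toℕ j → toℕ j ≤ toℕ k →
       InI mv x i → InI mv x k → InI mv x j)

StronglySingular : ∀ {v} {H : Graph v} {n} → PreMovement H n → Fin v → Set
StronglySingular {n = n} mv x =
    Singular mv x
  × ((∀ i → ¬ InI mv x i) ⊎ InI mv x fzero ⊎ InI mv x (fromℕ n))

_△ˣ_ : ∀ {v} {H : Graph v} {n} → PreMovement H n → Fin v → PreMovement H n
(X , M) △ˣ x = (λ i → X i ⊕ ⁅ x ⁆) , M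

flipSide : Side → Side
flipSide 𝟎 = ∞
flipSide ∞ = 𝟎

swapAt : ∀ {v} → Fin v → Tagged v → Tagged v
swapAt x (y , s) with x ≟ᶠ y
... | yes _ = y , flipSide s
... | no  _ = y , s

-- As a graph on
-- ((X △ {x}) × {0}) ∪ ((Y △ {x}) × {∞}); edges are restricted to that vertex set
-- (this only matters in the degenerate case that both (x,0),(x,∞) are vertices of L).
_△ᴸ_ : ∀ {v} → (Tagged v → Tagged v → Set) → Fin v →
       Subset v → Subset v → Tagged v → Tagged v → Set
(L △ᴸ x) X Y u w =
  InV (X ⊕ ⁅ x ⁆) (Y ⊕ ⁅ x ⁆) u × InV (X ⊕ ⁅ x ⁆) (Y ⊕ ⁅ x ⁆) w × L (swapAt x u) (swapAt x w)

-- Flipping x in every X_i leaves all other vertices untouched and toggles x, so the moves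
-- stay legal (x is never an inner vertex, and at an end of a move x still lies in exactly
-- one of the two consecutive sets). Since I_x is an interval containing 0 or n, its
-- complement is again such an interval, so after the flip the copies of x still form a
-- single vertical path of the new multigraph, and every move ending at x attaches to it.
-- Contracting the copies of x onto one vertex of that path maps every component of the old
-- multigraph into a component of the new one; the same argument backwards shows that the
-- induced pairing changes exactly by exchanging (x,0) and (x,∞).
module Submission where

open import Defs hiding (sym)
open import Data.Bool using (true; false; not; _xor_; if_then_else_)
open import Data.Bool.Properties using (xor-assoc; xor-comm; xor-same; xor-identityʳ; not-involutive; not-¬)
open import Data.Nat using (ℕ; suc; z≤n)
open import Data.Fin using (Fin; inject₁; fromℕ; _≤_) renaming (zero to fzero; suc to fsuc; _≟_ to _≟ᶠ_)
open import Data.Fin.Properties using (≤-refl; ≤-trans; ≤fromℕ; i≤inject₁[j]⇒i≤1+j)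
open import Data.Fin.Induction using (<-weakInduction; >-weakInduction)
open import Data.Fin.Subset using (Subset; _∈_; _∉_; _∩_; _∪_; ⁅_⁆)
open import Data.Fin.Subset.Properties using (_∈?_; x∈⁅x⁆; x∈⁅y⁆⇒x≡y; x∈p∩q⁻; x∈p∩q⁺; x∈p∪q⁻; p⊆p∪q; q⊆p∪q)
open import Data.Vec using ([]; _∷_; lookup)
open import Data.Vec.Properties using (lookup-zipWith; []=⇒lookup; lookup⇒[]=)
open import Data.List.Membership.Propositional.Properties using (∈-++⁻; ∈-++⁺ʳ)
open import Data.List.Relation.Unary.Any using (here; there)
import Data.List.Relation.Unary.All as All
open import Data.List.Relation.Unary.AllPairs using (_∷_)
open import Data.Product using (_×_; _,_; proj₁; proj₂)
open import Data.Sum using (_⊎_; inj₁; inj₂)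
open import Data.Empty using (⊥-elim)
open import Function using (_∘_)
open import Function.Bundles using (_⇔_; mk⇔; Equivalence)
open import Function.Properties.Equivalence using () renaming (sym to ⇔-sym)
open import Relation.Nullary using (¬_; Dec; yes; no; contradiction)
open import Relation.Binary.PropositionalEquality using (_≡_; _≢_; refl; sym; trans; cong; cong₂; subst; subst₂; module ≡-Reasoning)
open import Relation.Binary.Construct.Closure.ReflexiveTransitive using (ε; _◅_; _◅◅_)
open import Relation.Binary.Construct.Closure.Symmetric using (fwd)
open import Relation.Binary.Construct.Closure.Equivalence using (symmetric; isEquivalence; gfold; setoid)
import Relation.Binary.Reasoning.Setoid as SetoidReasoning

∈-resp-lookup : ∀ {v} {A B : Subset v} {y} → lookup A y ≡ lookup B y → y ∈ A → y ∈ B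
∈-resp-lookup {A = A} {B} {y} eq y∈A = lookup⇒[]= y B (trans (sym eq) ([]=⇒lookup y∈A))

∉⇒lookup≡false : ∀ {v} {A : Subset v} {y} → y ∉ A → lookup A y ≡ false
∉⇒lookup≡false {A = A} {y} y∉A with lookup A y in eq
... | true  = ⊥-elim (y∉A (lookup⇒[]= y A eq))
... | false = refl

∈-lookup-not : ∀ {v} {A B : Subset v} {y} → lookup A y ≡ not (lookup B y) → y ∈ A ⇔ y ∉ B
∈-lookup-not {A = A} {B} {y} eq = mk⇔ to from
  where
  to : y ∈ A → y ∉ B
  to y∈A y∈B = not-¬ (trans ([]=⇒lookup y∈A) (sym ([]=⇒lookup y∈B))) eq
  from : y ∉ B → y ∈ A
  from y∉B = lookup⇒[]= y A (trans eq (cong not (∉⇒lookup≡false y∉B)))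

∈⊕⇒∉∩ : ∀ {v} {A B : Subset v} {y} → y ∈ A ⊕ B → y ∉ A ∩ B
∈⊕⇒∉∩ {A = A} {B} {y} y∈A⊕B y∈A∩B with x∈p∩q⁻ A B y∈A∩B
... | y∈A , y∈B = contradiction (begin
  true                      ≡⟨ []=⇒lookup y∈A⊕B ⟨
  lookup (A ⊕ B) y          ≡⟨ lookup-zipWith _xor_ y A B ⟩
  lookup A y xor lookup B y ≡⟨ cong₂ _xor_ ([]=⇒lookup y∈A) ([]=⇒lookup y∈B) ⟩
  false                     ∎) λ ()
  where open ≡-Reasoning

xor-shared-cancel : ∀ a b s → (a xor s) xor (b xor s) ≡ a xor b
xor-shared-cancel a b s = begin
  (a xor s) xor (b xor s) ≡⟨ xor-assoc a s (b xor s) ⟩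
  a xor (s xor (b xor s)) ≡⟨ cong (λ t → a xor (s xor t)) (xor-comm b s) ⟩
  a xor (s xor (s xor b)) ≡⟨ cong (a xor_) (sym (xor-assoc s s b)) ⟩
  a xor ((s xor s) xor b) ≡⟨ cong (λ t → a xor (t xor b)) (xor-same s) ⟩
  a xor b                 ∎
  where open ≡-Reasoning

⊕-shared-cancel : ∀ {v} (A B S : Subset v) → (A ⊕ S) ⊕ (B ⊕ S) ≡ A ⊕ B
⊕-shared-cancel []      []      []      = refl
⊕-shared-cancel (a ∷ A) (b ∷ B) (s ∷ S) = cong₂ _∷_ (xor-shared-cancel a b s) (⊕-shared-cancel A B S)

lookup-⊕⁅⁆-≢ : ∀ {v} (A : Subset v) {x y} → x ≢ y → lookup (A ⊕ ⁅ x ⁆) y ≡ lookup A y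
lookup-⊕⁅⁆-≢ A {x} {y} x≢y = begin
  lookup (A ⊕ ⁅ x ⁆) y         ≡⟨ lookup-zipWith _xor_ y A ⁅ x ⁆ ⟩
  lookup A y xor lookup ⁅ x ⁆ y ≡⟨ cong (lookup A y xor_) (∉⇒lookup≡false (x≢y ∘ sym ∘ x∈⁅y⁆⇒x≡y x)) ⟩
  lookup A y xor false          ≡⟨ xor-identityʳ _ ⟩
  lookup A y                    ∎
  where open ≡-Reasoning

lookup-⊕⁅⁆-≡ : ∀ {v} (A : Subset v) x → lookup (A ⊕ ⁅ x ⁆) x ≡ not (lookup A x)
lookup-⊕⁅⁆-≡ A x rewrite lookup-zipWith _xor_ x A ⁅ x ⁆ | []=⇒lookup (x∈⁅x⁆ x) with lookup A x
... | true  = refl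
... | false = refl

record FlippedAt {v} {I : Set} (x : Fin v) (X X' : I → Subset v) : Set where
  field
    unchanged : ∀ i {y} → x ≢ y → lookup (X' i) y ≡ lookup (X i) y
    toggled   : ∀ i → lookup (X' i) x ≡ not (lookup (X i) x)
open FlippedAt

flippedAt-⊕ : ∀ {v} {I : Set} (x : Fin v) (X : I → Subset v) → FlippedAt x X (λ i → X i ⊕ ⁅ x ⁆)
flippedAt-⊕ x X = record { unchanged = λ i → lookup-⊕⁅⁆-≢ (X i) ; toggled = λ i → lookup-⊕⁅⁆-≡ (X i) x }

flippedAt-sym : ∀ {v} {I : Set} {x : Fin v} {X X' : I → Subset v} → FlippedAt x X X' → FlippedAt x X' X
flippedAt-sym flipped = record
  { unchanged = λ i x≢y → sym (unchanged flipped i x≢y)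
  ; toggled   = λ i → trans (sym (not-involutive _)) (cong not (sym (toggled flipped i)))
  }

Convex : ∀ {n} → (Fin (suc n) → Set) → Set
Convex P = ∀ i j k → i ≤ j → j ≤ k → P i → P k → P j

Anchored : ∀ {n} → (Fin (suc n) → Set) → Set
Anchored {n} P = (∀ i → ¬ P i) ⊎ P fzero ⊎ P (fromℕ n)

module _ {n} {P Q : Fin (suc n) → Set} (P⇔Q : ∀ i → P i ⇔ Q i) where
  open Equivalence

  Convex-resp : Convex P → Convex Q
  Convex-resp convex i j k i≤j j≤k Qi Qk =
    to (P⇔Q j) (convex i j k i≤j j≤k (from (P⇔Q i) Qi) (from (P⇔Q k) Qk))

  Anchored-resp : Anchored P → Anchored Q
  Anchored-resp (inj₁ empty)     = inj₁ (λ i → empty i ∘ from (P⇔Q i))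
  Anchored-resp (inj₂ (inj₁ P0)) = inj₂ (inj₁ (to (P⇔Q fzero) P0))
  Anchored-resp (inj₂ (inj₂ Pn)) = inj₂ (inj₂ (to (P⇔Q (fromℕ n)) Pn))

module _ {n} {P : Fin (suc n) → Set} where

  Convex-complement : Convex P → Anchored P → Convex (¬_ ∘ P)
  Convex-complement _      (inj₁ empty)     _ j _ _   _   _   _   Pj = empty j Pj
  Convex-complement convex (inj₂ (inj₁ P0)) i j _ i≤j _   ¬Pi _   Pj = ¬Pi (convex fzero i j z≤n i≤j P0 Pj)
  Convex-complement convex (inj₂ (inj₂ Pn)) _ j k _   j≤k _   ¬Pk Pj = ¬Pk (convex j k (fromℕ n) j≤k (≤fromℕ k) Pj Pn)

  Anchored-complement : (∀ i → Dec (P i)) → Convex P → Anchored (¬_ ∘ P)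
  Anchored-complement P? convex with P? fzero | P? (fromℕ n)
  ... | no ¬P0 | _      = inj₂ (inj₁ ¬P0)
  ... | yes _  | no ¬Pn = inj₂ (inj₂ ¬Pn)
  ... | yes P0 | yes Pn = inj₁ (λ i ¬Pi → ¬Pi (convex fzero i (fromℕ n) z≤n (≤fromℕ i) P0 Pn))

module _ {v} {H : Graph v} {n} {M : Fin n → Path H} {y : Fin v} {X X' : Fin (suc n) → Subset v}
         (InI⇔ : ∀ i → InI (X , M) y i ⇔ InI (X' , M) y i) where

  Singular-resp : Singular (X , M) y → Singular (X' , M) y
  Singular-resp (noInner , convex) = noInner , Convex-resp InI⇔ convex

  StronglySingular-resp : StronglySingular (X , M) y → StronglySingular (X' , M) y
  StronglySingular-resp (singular , anchored) = Singular-resp singular , Anchored-resp InI⇔ anchored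

module _ {v} {H : Graph v} {n} {M : Fin n → Path H} {X X' : Fin (suc n) → Subset v} {x : Fin v}
         (flipped : FlippedAt x X X') where

  stronglySingular-flip : StronglySingular (X , M) x → StronglySingular (X' , M) x
  stronglySingular-flip ((noInner , convex) , anchored) =
      (noInner , Convex-resp complement (Convex-complement convex anchored))
    , Anchored-resp complement (Anchored-complement (λ i → x ∈? X i) convex)
    where
    complement : ∀ i → (¬ InI (X , M) x i) ⇔ InI (X' , M) x i
    complement i = ⇔-sym (∈-lookup-not (toggled flipped i))

  singularity-flip : StronglySingular (X , M) x → ∀ y →
                     (Singular (X , M) y ⇔ Singular (X' , M) y)
                   × (StronglySingular (X , M) y ⇔ StronglySingular (X' , M) y)
  singularity-flip ss y with x ≟ᶠ y
  ... | yes refl = mk⇔ (λ _ → proj₁ ss') (λ _ → proj₁ ss) , mk⇔ (λ _ → ss') (λ _ → ss)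
    where ss' = stronglySingular-flip ss
  ... | no x≢y = mk⇔ (Singular-resp {M = M} InI⇔) (Singular-resp {M = M} (⇔-sym ∘ InI⇔))
               , mk⇔ (StronglySingular-resp {M = M} InI⇔) (StronglySingular-resp {M = M} (⇔-sym ∘ InI⇔))
    where
    InI⇔ : ∀ i → InI (X , M) y i ⇔ InI (X' , M) y i
    InI⇔ i = mk⇔ (∈-resp-lookup (sym (unchanged flipped i x≢y))) (∈-resp-lookup (unchanged flipped i x≢y))

EndOf : ∀ {v} {H : Graph v} → Fin v → Path H → Set
EndOf y P = y ≡ start P ⊎ y ≡ end P

onPath⇒inner⊎end : ∀ {v} {H : Graph v} {y} (P : Path H) → OnPath y P → InnerOf y P ⊎ EndOf y P
onPath⇒inner⊎end P (here y≡s) = inj₂ (inj₁ y≡s)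
onPath⇒inner⊎end P (there y∈rest) with ∈-++⁻ (inner P) y∈rest
... | inj₁ y∈inner     = inj₁ y∈inner
... | inj₂ (here y≡e) = inj₂ (inj₂ y≡e)

start≢end : ∀ {v} {H : Graph v} (P : Path H) → start P ≢ end P
start≢end P with distinct P
... | start∉rest ∷ _ = All.lookup start∉rest (∈-++⁺ʳ (inner P) (here refl))

end-toggles : ∀ {v} {H : Graph v} {A B : Subset v} {P : Path H} {y} →
              A ⊕ B ≡ ⁅ start P ⁆ ∪ ⁅ end P ⁆ → EndOf y P → y ∈ A ⊕ B
end-toggles {P = P} A⊕B≡ends (inj₁ refl) = subst (_ ∈_) (sym A⊕B≡ends) (p⊆p∪q ⁅ end P ⁆ (x∈⁅x⁆ _))
end-toggles {P = P} A⊕B≡ends (inj₂ refl) = subst (_ ∈_) (sym A⊕B≡ends) (q⊆p∪q ⁅ start P ⁆ _ (x∈⁅x⁆ _))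

toggles⇒∈-moveIdx : ∀ {v} {H : Graph v} {n} (mv : PreMovement H n) (i : Fin n) {y} →
                    y ∈ 𝓧 mv (inject₁ i) ⊕ 𝓧 mv (fsuc i) → y ∈ 𝓧 mv (moveIdx mv i y)
toggles⇒∈-moveIdx (X , _) i {y} toggles with lookup (X (inject₁ i)) y in eq
... | true  = lookup⇒[]= y (X (inject₁ i)) eq
... | false = lookup⇒[]= y (X (fsuc i)) (begin
  lookup (X (fsuc i)) y                              ≡⟨ cong (_xor lookup (X (fsuc i)) y) eq ⟨
  lookup (X (inject₁ i)) y xor lookup (X (fsuc i)) y ≡⟨ lookup-zipWith _xor_ y (X (inject₁ i)) (X (fsuc i)) ⟨
  lookup (X (inject₁ i) ⊕ X (fsuc i)) y              ≡⟨ []=⇒lookup toggles ⟩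
  true                                               ∎)
  where open ≡-Reasoning

isMovement-⊕ : ∀ {v} {H : Graph v} {n} {mv : PreMovement H n} {x} →
               IsMovement mv → Singular mv x → IsMovement (mv △ˣ x)
isMovement-⊕ {mv = X , M} {x} (1≤n , moves) (noInner , _) = 1≤n , λ i → ends-toggle i , disjoint i
  where
  ends-toggle : ∀ i → (X (inject₁ i) ⊕ ⁅ x ⁆) ⊕ (X (fsuc i) ⊕ ⁅ x ⁆) ≡ ⁅ start (M i) ⁆ ∪ ⁅ end (M i) ⁆
  ends-toggle i = trans (⊕-shared-cancel (X (inject₁ i)) (X (fsuc i)) ⁅ x ⁆) (proj₁ (moves i))

  disjoint : ∀ i y → OnPath y (M i) → y ∉ (X (inject₁ i) ⊕ ⁅ x ⁆) ∩ (X (fsuc i) ⊕ ⁅ x ⁆)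
  disjoint i y y∈M y∈∩ with x ≟ᶠ y | x∈p∩q⁻ (X (inject₁ i) ⊕ ⁅ x ⁆) _ y∈∩
  ... | no x≢y | y∈Xᵢ , y∈Xᵢ₊₁ = proj₂ (moves i) y y∈M
        (x∈p∩q⁺ (∈-resp-lookup (lookup-⊕⁅⁆-≢ (X (inject₁ i)) x≢y) y∈Xᵢ
               , ∈-resp-lookup (lookup-⊕⁅⁆-≢ (X (fsuc i)) x≢y) y∈Xᵢ₊₁))
  ... | yes refl | _ with onPath⇒inner⊎end (M i) y∈M
  ...   | inj₁ inner = noInner i inner
  ...   | inj₂ isEnd = ∈⊕⇒∉∩ (end-toggles {P = M i} (ends-toggle i) isEnd) y∈∩

inject₁≤suc : ∀ {n} (i : Fin n) → inject₁ i ≤ fsuc i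
inject₁≤suc i = i≤inject₁[j]⇒i≤1+j ≤-refl

module _ {v} {H : Graph v} {n} (mv : PreMovement H n) (y : Fin v) where

  vertical-path-from-0 : ∀ j → (∀ k → k ≤ j → y ∈ 𝓧 mv k) → RConnected mv (y , fzero) (y , j)
  vertical-path-from-0 = <-weakInduction P (λ _ → ε) step
    where
    P : Fin (suc n) → Set
    P j = (∀ k → k ≤ j → y ∈ 𝓧 mv k) → RConnected mv (y , fzero) (y , j)
    step : ∀ i → P (inject₁ i) → P (fsuc i)
    step i path below =
      path (λ k k≤i → below k (i≤inject₁[j]⇒i≤1+j k≤i))
      ◅◅ fwd (vertical i y (below (inject₁ i) (inject₁≤suc i)) (below (fsuc i) ≤-refl)) ◅ ε

  vertical-path-to-n : ∀ j → (∀ k → j ≤ k → y ∈ 𝓧 mv k) → RConnected mv (y , j) (y , fromℕ n)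
  vertical-path-to-n = >-weakInduction P (λ _ → ε) step
    where
    P : Fin (suc n) → Set
    P j = (∀ k → j ≤ k → y ∈ 𝓧 mv k) → RConnected mv (y , j) (y , fromℕ n)
    step : ∀ i → P (fsuc i) → P (inject₁ i)
    step i path above =
      fwd (vertical i y (above (inject₁ i) ≤-refl) (above (fsuc i) (inject₁≤suc i)))
      ◅ path (λ k i+1≤k → above k (≤-trans (inject₁≤suc i) i+1≤k))

module Contraction {v} {H : Graph v} {n} {M : Fin n → Path H} {X X' : Fin (suc n) → Subset v} {x : Fin v}
                   (flipped : FlippedAt x X X') (movement' : IsMovement (X' , M))
                   (ss' : StronglySingular (X' , M) x) where

  private
    mv mv' : PreMovement H n
    mv  = X , M
    mv' = X' , M

  open SetoidReasoning (setoid (REdge mv')) using (begin_; _∎; step-≈-⟩; step-≈-⟨; step-≡-⟩; step-≡-⟨)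

  -- Every copy of x in X' reaches the hub vertically, since those copies form an interval through 0 or n.
  hub : RVertex mv'
  hub with x ∈? X' fzero
  ... | yes _ = x , fzero
  ... | no _  = x , fromℕ n

  hub-reaches : ∀ j → x ∈ X' j → RConnected mv' hub (x , j)
  hub-reaches j x∈X'ⱼ with x ∈? X' fzero | proj₂ ss'
  ... | yes x∈X'₀ | _                  = vertical-path-from-0 mv' x j
                                           (λ k k≤j → convex fzero k j z≤n k≤j x∈X'₀ x∈X'ⱼ)
    where convex = proj₂ (proj₁ ss')
  ... | no _      | inj₁ empty         = ⊥-elim (empty j x∈X'ⱼ)
  ... | no x∉X'₀  | inj₂ (inj₁ x∈X'₀) = ⊥-elim (x∉X'₀ x∈X'₀)
  ... | no _      | inj₂ (inj₂ x∈X'ₙ) = symmetric _ (vertical-path-to-n mv' x j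
                                           (λ k j≤k → convex j k (fromℕ n) j≤k (≤fromℕ k) x∈X'ⱼ x∈X'ₙ))
    where convex = proj₂ (proj₁ ss')

  hub-reaches-move : ∀ i → EndOf x (M i) → RConnected mv' hub (x , moveIdx mv' i x)
  hub-reaches-move i isEnd =
    hub-reaches _ (toggles⇒∈-moveIdx mv' i (end-toggles {P = M i} (proj₁ (proj₂ movement' i)) isEnd))

  moveIdx-flip : ∀ i {y} → x ≢ y → moveIdx mv' i y ≡ moveIdx mv i y
  moveIdx-flip i x≢y = cong (λ b → if b then inject₁ i else fsuc i) (unchanged flipped (inject₁ i) x≢y)

  move : ∀ i → RConnected mv' (start (M i) , moveIdx mv' i (start (M i))) (end (M i) , moveIdx mv' i (end (M i)))
  move i = fwd (moveEdge i) ◅ ε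

  collapse : RVertex mv → RVertex mv'
  collapse (y , i) with x ≟ᶠ y
  ... | yes _ = hub
  ... | no _  = y , i

  collapse-edge : ∀ {a b} → REdge mv a b → RConnected mv' (collapse a) (collapse b)
  collapse-edge (vertical i y y∈Xᵢ y∈Xᵢ₊₁) with x ≟ᶠ y
  ... | yes _   = ε
  ... | no x≢y = fwd (vertical i y (∈-resp-lookup (sym (unchanged flipped _ x≢y)) y∈Xᵢ)
                                   (∈-resp-lookup (sym (unchanged flipped _ x≢y)) y∈Xᵢ₊₁)) ◅ ε
  collapse-edge (moveEdge i) with x ≟ᶠ start (M i) | x ≟ᶠ end (M i)
  ... | yes x≡s | yes x≡e = ⊥-elim (start≢end (M i) (trans (sym x≡s) x≡e))
  ... | yes x≡s | no x≢e  = begin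
    hub                                   ≈⟨ hub-reaches-move i (inj₁ x≡s) ⟩
    (x , moveIdx mv' i x)                 ≡⟨ cong (λ z → z , moveIdx mv' i z) x≡s ⟩
    (start (M i) , moveIdx mv' i _)       ≈⟨ move i ⟩
    (end (M i) , moveIdx mv' i (end (M i))) ≡⟨ cong (end (M i) ,_) (moveIdx-flip i x≢e) ⟩
    (end (M i) , moveIdx mv i (end (M i)))  ∎
  ... | no x≢s  | yes x≡e = begin
    (start (M i) , moveIdx mv i (start (M i)))  ≡⟨ cong (start (M i) ,_) (moveIdx-flip i x≢s) ⟨
    (start (M i) , moveIdx mv' i (start (M i))) ≈⟨ move i ⟩
    (end (M i) , moveIdx mv' i _)               ≡⟨ cong (λ z → z , moveIdx mv' i z) x≡e ⟨
    (x , moveIdx mv' i x)                       ≈⟨ hub-reaches-move i (inj₂ x≡e) ⟨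
    hub                                         ∎
  ... | no x≢s  | no x≢e  = begin
    (start (M i) , moveIdx mv i (start (M i)))  ≡⟨ cong (start (M i) ,_) (moveIdx-flip i x≢s) ⟨
    (start (M i) , moveIdx mv' i (start (M i))) ≈⟨ move i ⟩
    (end (M i) , moveIdx mv' i (end (M i)))     ≡⟨ cong (end (M i) ,_) (moveIdx-flip i x≢e) ⟩
    (end (M i) , moveIdx mv i (end (M i)))      ∎

  collapse-self : ∀ i → collapse (x , i) ≡ hub
  collapse-self i with x ≟ᶠ x
  ... | yes _   = refl
  ... | no x≢x = ⊥-elim (x≢x refl)

  collapse-other : ∀ {y} i → x ≢ y → collapse (y , i) ≡ (y , i)
  collapse-other {y} i x≢y with x ≟ᶠ y
  ... | yes x≡y = ⊥-elim (x≢y x≡y)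
  ... | no _    = refl

  collapse-swap : ∀ u → InV (X' fzero) (X' (fromℕ n)) u → RConnected mv' (collapse (emb (swapAt x u))) (emb u)
  collapse-swap (y , 𝟎) y∈X'₀ with x ≟ᶠ y
  ... | yes refl = begin
    collapse (x , fromℕ n) ≡⟨ collapse-self (fromℕ n) ⟩
    hub                    ≈⟨ hub-reaches fzero y∈X'₀ ⟩
    (x , fzero)            ∎
  ... | no x≢y   = begin
    collapse (y , fzero)   ≡⟨ collapse-other fzero x≢y ⟩
    (y , fzero)            ∎
  collapse-swap (y , ∞) y∈X'ₙ with x ≟ᶠ y
  ... | yes refl = begin
    collapse (x , fzero)   ≡⟨ collapse-self fzero ⟩
    hub                    ≈⟨ hub-reaches (fromℕ n) y∈X'ₙ ⟩
    (x , fromℕ n)          ∎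
  ... | no x≢y   = begin
    collapse (y , fromℕ n) ≡⟨ collapse-other (fromℕ n) x≢y ⟩
    (y , fromℕ n)          ∎

  transfer : ∀ {u w} → InV (X' fzero) (X' (fromℕ n)) u → InV (X' fzero) (X' (fromℕ n)) w →
             RConnected mv (emb (swapAt x u)) (emb (swapAt x w)) → RConnected mv' (emb u) (emb w)
  transfer {u} {w} u∈V w∈V path = begin
    emb u                        ≈⟨ collapse-swap u u∈V ⟨
    collapse (emb (swapAt x u))  ≈⟨ gfold (isEquivalence _) collapse collapse-edge path ⟩
    collapse (emb (swapAt x w))  ≈⟨ collapse-swap w w∈V ⟩
    emb w                        ∎

flipSide-involutive : ∀ s → flipSide (flipSide s) ≡ s
flipSide-involutive 𝟎 = refl
flipSide-involutive ∞ = refl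

swapAt-self : ∀ {v} (x : Fin v) s → swapAt x (x , s) ≡ (x , flipSide s)
swapAt-self x s with x ≟ᶠ x
... | yes _   = refl
... | no x≢x = ⊥-elim (x≢x refl)

swapAt-other : ∀ {v} {x y : Fin v} s → x ≢ y → swapAt x (y , s) ≡ (y , s)
swapAt-other {x = x} {y} s x≢y with x ≟ᶠ y
... | yes x≡y = ⊥-elim (x≢y x≡y)
... | no _    = refl

swapAt-involutive : ∀ {v} (x : Fin v) u → swapAt x (swapAt x u) ≡ u
swapAt-involutive x (y , s) with x ≟ᶠ y
... | yes refl = trans (swapAt-self x (flipSide s)) (cong (x ,_) (flipSide-involutive s))
... | no x≢y   = swapAt-other s x≢y

swapAt-injective : ∀ {v} (x : Fin v) {u w} → swapAt x u ≡ swapAt x w → u ≡ w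
swapAt-injective x {u} {w} eq = begin
  u                         ≡⟨ swapAt-involutive x u ⟨
  swapAt x (swapAt x u)     ≡⟨ cong (swapAt x) eq ⟩
  swapAt x (swapAt x w)     ≡⟨ swapAt-involutive x w ⟩
  w                         ∎
  where open ≡-Reasoning

InV-swapAt : ∀ {v} {X Y : Subset v} {x} → x ∈ X ∪ Y → ∀ u → InV (X ⊕ ⁅ x ⁆) (Y ⊕ ⁅ x ⁆) u → InV X Y (swapAt x u)
InV-swapAt {X = X} {Y} {x} x∈X∪Y (y , 𝟎) y∈X⊕x with x ≟ᶠ y
... | no x≢y   = ∈-resp-lookup (lookup-⊕⁅⁆-≢ X x≢y) y∈X⊕x
... | yes refl with x∈p∪q⁻ X Y x∈X∪Y
...   | inj₂ x∈Y = x∈Y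
...   | inj₁ x∈X = ⊥-elim (Equivalence.to (∈-lookup-not (lookup-⊕⁅⁆-≡ X x)) y∈X⊕x x∈X)
InV-swapAt {X = X} {Y} {x} x∈X∪Y (y , ∞) y∈Y⊕x with x ≟ᶠ y
... | no x≢y   = ∈-resp-lookup (lookup-⊕⁅⁆-≢ Y x≢y) y∈Y⊕x
... | yes refl with x∈p∪q⁻ X Y x∈X∪Y
...   | inj₁ x∈X = x∈X
...   | inj₂ x∈Y = ⊥-elim (Equivalence.to (∈-lookup-not (lookup-⊕⁅⁆-≡ Y x)) y∈Y⊕x x∈Y)

inducedPairing-⊕ : ∀ {v} {H : Graph v} {n} {mv : PreMovement H n} {X Y : Subset v}
                     {L : Tagged v → Tagged v → Set} {x} →
                   IsMovement mv → StronglySingular mv x → x ∈ X ∪ Y → InducedPairingIs mv X Y L →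
                   InducedPairingIs (mv △ˣ x) (X ⊕ ⁅ x ⁆) (Y ⊕ ⁅ x ⁆) ((L △ᴸ x) X Y)
inducedPairing-⊕ {mv = mv} {L = L} {x} movement ss x∈X∪Y (refl , refl , L⇔induced) =
  refl , refl , λ u w → mk⇔ (to u w) (from u w)
  where
  X₀ = 𝓧 mv fzero
  Xₙ = 𝓧 mv (fromℕ _)
  mv' = mv △ˣ x

  flipped : FlippedAt x (𝓧 mv) (𝓧 mv')
  flipped = flippedAt-⊕ x (𝓧 mv)

  open Contraction flipped (isMovement-⊕ {mv = mv} movement (proj₁ ss)) (stronglySingular-flip {M = 𝓜 mv} flipped ss)
    using () renaming (transfer to forward)
  open Contraction (flippedAt-sym flipped) movement ss
    using () renaming (transfer to backward)

  to : ∀ u w → (L △ᴸ x) X₀ Xₙ u w → InducedEdge mv' u w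
  to u w (u∈V , w∈V , Lsusw) with Equivalence.to (L⇔induced _ _) Lsusw
  ... | su≢sw , _ , _ , path = su≢sw ∘ cong (swapAt x) , u∈V , w∈V , forward u∈V w∈V path

  from : ∀ u w → InducedEdge mv' u w → (L △ᴸ x) X₀ Xₙ u w
  from u w (u≢w , u∈V , w∈V , path) =
    u∈V , w∈V , Equivalence.from (L⇔induced _ _)
                  (u≢w ∘ swapAt-injective x , su∈V , sw∈V , backward su∈V sw∈V path')
    where
    su∈V = InV-swapAt x∈X∪Y u u∈V
    sw∈V = InV-swapAt x∈X∪Y w w∈V
    path' : RConnected mv' (emb (swapAt x (swapAt x u))) (emb (swapAt x (swapAt x w)))
    path' = subst₂ (λ a b → RConnected mv' (emb a) (emb b))
                   (sym (swapAt-involutive x u)) (sym (swapAt-involutive x w)) path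

lemma16 : ∀ {v : ℕ} (H : Graph v) → Connected H →
          (X Y : Subset v) (L : Tagged v → Tagged v → Set) → IsPairing X Y L →
          ∀ {n : ℕ} (mv : PreMovement H n) → IsLMovement X Y L mv →
          (x : Fin v) → x ∈ (X ∪ Y) → StronglySingular mv x →
            IsLMovement (X ⊕ ⁅ x ⁆) (Y ⊕ ⁅ x ⁆) ((L △ᴸ x) X Y) (mv △ˣ x)
          × (∀ (y : Fin v) → (Singular mv y ⇔ Singular (mv △ˣ x) y)
                           × (StronglySingular mv y ⇔ StronglySingular (mv △ˣ x) y))
lemma16 _ _ _ _ _ _ mv (movement , pairing) x x∈X∪Y ss =
    (isMovement-⊕ {mv = mv} movement (proj₁ ss) , inducedPairing-⊕ movement ss x∈X∪Y pairing)
  , singularity-flip {M = 𝓜 mv} (flippedAt-⊕ x (𝓧 mv)) ss
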